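{- Let $n,s$ be positive integers with $\frac13 n\le s\le\frac12 n$, and let $G$ be a triangle-free graph on $n$ vertices containing two disjoint independent sets $A$ and $A'$ with $|A|=s$ and $|A'|\ge 3s-n$. Suppose that (i) $\deg(a)\le s$ for all $a\in A$, and (ii) $\mathrm{N}(a')=A$ for all $a'\in A'$. Then $e(G)\le n^2-4ns+5s^2$.
   Context: $\mathrm{N}(v)$ denotes the neighbourhood of $v$ and $e(G)$ the number of edges of $G$. -}

module Defs where

open import Data.Nat using (ℕ; _+_; _<_)
open import Data.Bool using (Bool; true; false)
open import Data.Fin using (Fin)
open import Data.Fin.Subset using (Subset; _∈_; ⊥; ∁; _∩_) renaming (∣_∣ to card)
open import Data.Vec using (Vec; tabulate)
open import Data.List using (List; length; filterᵇ; allFin; cartesianProduct)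
open import Data.Product using (_×_; _,_; proj₁; proj₂)
open import Data.Fin using (toℕ)
import Data.Nat as ℕ
open import Data.Bool using (_∧_)
open import Relation.Binary.PropositionalEquality using (_≡_)
open import Relation.Nullary using (¬_)

record Graph (n : ℕ) : Set where
  field
    adj    : Fin n → Fin n → Bool
    sym    : ∀ u v → adj u v ≡ adj v u
    irrefl : ∀ v → adj v v ≡ false
open Graph public

N : ∀ {n} → Graph n → Fin n → Subset n
N G v = tabulate (λ u → adj G v u)

deg : ∀ {n} → Graph n → Fin n → ℕ
deg G v = card (N G v)

e : ∀ {n} → Graph n → ℕ
e {n} G = length (filterᵇ (λ p → (toℕ (proj₁ p) ℕ.<ᵇ toℕ (proj₂ p)) ∧ adj G (proj₁ p) (proj₂ p))
                           (cartesianProduct (allFin n) (allFin n)))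

TriangleFree : ∀ {n} → Graph n → Set
TriangleFree {n} G = ∀ (x y z : Fin n) → adj G x y ≡ true → adj G y z ≡ true → adj G x z ≡ true → Data.Empty.⊥
  where import Data.Empty

Independent : ∀ {n} → Graph n → Subset n → Set
Independent G S = ∀ x y → x ∈ S → y ∈ S → adj G x y ≡ false

Disjoint : ∀ {n} → Subset n → Subset n → Set
Disjoint S T = S ∩ T ≡ ⊥

module Submission where

-- Proof of Lemma 3.1.  Let R be the set of vertices outside A ∪ A', so that
-- s + |A'| + |R| = n.  Since every a' ∈ A' has N(a') = A, every edge of G
-- has an end in A or both ends in R.  Counting ordered adjacent pairs,
--   2 e(G) ≤ 2 ∑_{a ∈ A} deg(a) + 2 e(G[R]) ≤ 2 s² + |R|²/2,
-- where e(G[R]) ≤ |R|²/4 is Mantel's theorem for the triangle-free graph G[R].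
-- Finally |A'| ≥ 3s − n gives |R| ≤ 2(n − 2s), hence
--   e(G) ≤ s² + (n − 2s)² = n² − 4ns + 5s².

open import Defs hiding (sym)
open import Data.Nat using (ℕ; _+_; _*_; _≤_; _^_)
open import Data.Fin using (Fin)
open import Data.Fin.Subset using (Subset; _∈_) renaming (∣_∣ to card)
open import Relation.Binary.PropositionalEquality using (_≡_)

open import Data.Bool using (Bool; true; false; T; _∧_; not)
open import Data.Empty using (⊥; ⊥-elim)
open import Data.Fin using (zero; suc; toℕ)
open import Data.List using (List; _++_; map; length; filterᵇ; cartesianProduct; allFin; tabulate)
open import Data.List.Properties using (length-++; filter-++; map-tabulate)
open import Data.Nat using (zero; suc; z≤n; _<ᵇ_)
open import Data.Nat.Properties
open import Data.Nat.Tactic.RingSolver using (solve-∀)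
open import Data.Product using (_×_; _,_; proj₁; proj₂)
open import Data.Sum using (inj₁; inj₂)
import Data.Vec as Vec
open import Data.Vec.Properties using (lookup∘tabulate; lookup⇒[]=; lookup-zipWith; lookup-replicate)
open import Function using (_∘_)
open import Relation.Binary.PropositionalEquality using (refl; sym; trans; cong; cong₂; subst; subst₂)
open import Relation.Nullary.Decidable using (T?)

open import Algebra.Properties.Semiring.Sum +-*-semiring
  using (sum; sum-syntax; sum-cong-≗; ∑-distrib-+; ∑-comm; *-distribˡ-sum; *-distribʳ-sum)

open ≤-Reasoning

χ : Bool → ℕ
χ true = 1
χ false = 0

sum-mono-≤ : ∀ {m} {f g : Fin m → ℕ} → (∀ i → f i ≤ g i) → sum f ≤ sum g
sum-mono-≤ {zero} _ = z≤n
sum-mono-≤ {suc m} f≤g = +-mono-≤ (f≤g zero) (sum-mono-≤ (f≤g ∘ suc))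

sum-ones : ∀ m → ∑[ i < m ] 1 ≡ m
sum-ones zero = refl
sum-ones (suc m) = cong suc (sum-ones m)

sum-*-sum : ∀ {m k} (f : Fin m → ℕ) (g : Fin k → ℕ) →
  sum f * sum g ≡ ∑[ i < m ] ∑[ j < k ] (f i * g j)
sum-*-sum f g = trans (*-distribʳ-sum (sum g) f) (sum-cong-≗ (λ i → *-distribˡ-sum (f i) g))

card≡sum : ∀ {m} (S : Subset m) → card S ≡ ∑[ i < m ] χ (Vec.lookup S i)
card≡sum Vec.[] = refl
card≡sum (true Vec.∷ S) = cong suc (card≡sum S)
card≡sum (false Vec.∷ S) = card≡sum S

count-tabulate : ∀ {A : Set} {m} (p : A → Bool) (f : Fin m → A) →
  length (filterᵇ p (tabulate f)) ≡ ∑[ i < m ] χ (p (f i))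
count-tabulate {m = zero} p f = refl
count-tabulate {m = suc m} p f with p (f zero)
... | true = cong suc (count-tabulate p (f ∘ suc))
... | false = count-tabulate p (f ∘ suc)

count-++ : ∀ {A : Set} (p : A → Bool) (xs ys : List A) →
  length (filterᵇ p (xs ++ ys)) ≡ length (filterᵇ p xs) + length (filterᵇ p ys)
count-++ p xs ys = trans (cong length (filter-++ (T? ∘ p) xs ys)) (length-++ (filterᵇ p xs))

count-pairs : ∀ {m k} (p : Fin m × Fin k → Bool) →
  length (filterᵇ p (cartesianProduct (allFin m) (allFin k)))
    ≡ ∑[ u < m ] ∑[ v < k ] χ (p (u , v))
count-pairs {m} {k} p = trans (by-rows (λ u → u)) (sum-cong-≗ row)
  where
  by-rows : ∀ {l} (f : Fin l → Fin m) →
    length (filterᵇ p (cartesianProduct (tabulate f) (allFin k)))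
      ≡ ∑[ u < l ] length (filterᵇ p (map (f u ,_) (allFin k)))
  by-rows {zero} f = refl
  by-rows {suc l} f = trans (count-++ p (map (f zero ,_) (allFin k)) _)
                            (cong (length (filterᵇ p (map (f zero ,_) (allFin k))) +_) (by-rows (f ∘ suc)))
  row : ∀ u → length (filterᵇ p (map (u ,_) (allFin k))) ≡ ∑[ v < k ] χ (p (u , v))
  row u = trans (cong (length ∘ filterᵇ p) (map-tabulate (λ v → v) (u ,_)))
                (count-tabulate p (u ,_))

two-products≤squares : ∀ y w → 2 * (y * w) ≤ y * y + w * w
two-products≤squares y w with ≤-total y w
... | inj₁ y≤w with m≤n⇒∃[o]m+o≡n y≤w
...   | k , refl = subst (2 * (y * (y + k)) ≤_) (expand y k) (m≤m+n _ (k * k))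
  where
  expand : ∀ y k → 2 * (y * (y + k)) + k * k ≡ y * y + (y + k) * (y + k)
  expand = solve-∀
two-products≤squares y w | inj₂ w≤y with m≤n⇒∃[o]m+o≡n w≤y
...   | k , refl = subst (2 * ((w + k) * w) ≤_) (expand w k) (m≤m+n _ (k * k))
  where
  expand : ∀ w k → 2 * ((w + k) * w) + k * k ≡ (w + k) * (w + k) + w * w
  expand = solve-∀

-- Weighted Cauchy–Schwarz: (∑ fᵢgᵢ)² ≤ (∑ fᵢ)(∑ fᵢgᵢ²).  Expand both sides
-- as double sums over (i, j) and apply AM–GM to gᵢ, gⱼ in each term.
cauchy-schwarz : ∀ {m} (f g : Fin m → ℕ) →
  (∑[ i < m ] (f i * g i)) * (∑[ i < m ] (f i * g i))
    ≤ sum f * ∑[ i < m ] (f i * (g i * g i))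
cauchy-schwarz {m} f g = *-cancelˡ-≤ 2 (begin
  2 * (S * S)                                      ≡⟨ cong (2 *_) (sum-*-sum fg fg) ⟩
  2 * ∑[ i < m ] ∑[ j < m ] (fg i * fg j)          ≡⟨ double-sum-*ˡ ⟩
  ∑[ i < m ] ∑[ j < m ] (2 * (fg i * fg j))        ≤⟨ sum-mono-≤ (λ i → sum-mono-≤ (λ j → pointwise i j)) ⟩
  ∑[ i < m ] ∑[ j < m ] (f j * h i + f i * h j)    ≡⟨ double-sum-symmetrise ⟩
  2 * ∑[ i < m ] ∑[ j < m ] (f i * h j)            ≡⟨ cong (2 *_) (sym (sum-*-sum f h)) ⟩
  2 * (sum f * sum h)                              ∎)
  where
  fg h : Fin m → ℕ
  fg i = f i * g i
  h i = f i * (g i * g i)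
  S : ℕ
  S = sum fg
  double-sum-*ˡ : 2 * ∑[ i < m ] ∑[ j < m ] (fg i * fg j) ≡ ∑[ i < m ] ∑[ j < m ] (2 * (fg i * fg j))
  double-sum-*ˡ = trans (*-distribˡ-sum 2 (λ i → ∑[ j < m ] (fg i * fg j)))
                        (sum-cong-≗ (λ i → *-distribˡ-sum 2 (λ j → fg i * fg j)))
  pointwise : ∀ i j → 2 * (fg i * fg j) ≤ f j * h i + f i * h j
  pointwise i j = subst₂ _≤_ (lhs (f i) (g i) (f j) (g j)) (rhs (f i) (g i) (f j) (g j))
                         (*-monoʳ-≤ (f i * f j) (two-products≤squares (g i) (g j)))
    where
    lhs : ∀ x y z w → (x * z) * (2 * (y * w)) ≡ 2 * ((x * y) * (z * w))
    lhs = solve-∀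
    rhs : ∀ x y z w → (x * z) * (y * y + w * w) ≡ z * (x * (y * y)) + x * (z * (w * w))
    rhs = solve-∀
  double-sum-symmetrise :
    ∑[ i < m ] ∑[ j < m ] (f j * h i + f i * h j) ≡ 2 * ∑[ i < m ] ∑[ j < m ] (f i * h j)
  double-sum-symmetrise =
    trans (sum-cong-≗ (λ i → ∑-distrib-+ (λ j → f j * h i) (λ j → f i * h j)))
   (trans (∑-distrib-+ (λ i → ∑[ j < m ] (f j * h i)) (λ i → ∑[ j < m ] (f i * h j)))
   (trans (cong (_+ D) (∑-comm (λ i j → f j * h i)))
          (cong (D +_) (sym (+-identityʳ D)))))
    where
    D : ℕ
    D = ∑[ i < m ] ∑[ j < m ] (f i * h j)

module _ {n : ℕ} (G : Graph n) where

  adjχ : Fin n → Fin n → ℕ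
  adjχ u v = χ (adj G u v)

  adjχ-sym : ∀ u v → adjχ u v ≡ adjχ v u
  adjχ-sym u v = cong χ (Graph.sym G u v)

  deg≡sum : ∀ u → deg G u ≡ ∑[ v < n ] adjχ u v
  deg≡sum u = trans (card≡sum (N G u)) (sum-cong-≗ (λ v → cong χ (lookup∘tabulate (adj G u) v)))

  -- Handshake inequality: each edge uv with u < v is counted twice among the
  -- ordered adjacent pairs, once as (u, v) and once as (v, u).
  handshake : 2 * e G ≤ ∑[ u < n ] ∑[ v < n ] adjχ u v
  handshake = begin
    2 * e G                                        ≡⟨ cong (2 *_) edges≡sum ⟩
    2 * E                                          ≡⟨ cong (E +_) (trans (+-identityʳ E) (∑-comm (λ v u → below v u))) ⟩
    E + ∑[ u < n ] ∑[ v < n ] below v u            ≡⟨ sym (∑-distrib-+ (λ u → ∑[ v < n ] below u v) (λ u → ∑[ v < n ] below v u)) ⟩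
    ∑[ u < n ] (∑[ v < n ] below u v + ∑[ v < n ] below v u)
                                                   ≡⟨ sum-cong-≗ (λ u → sym (∑-distrib-+ (below u) (λ v → below v u))) ⟩
    ∑[ u < n ] ∑[ v < n ] (below u v + below v u)  ≤⟨ sum-mono-≤ (λ u → sum-mono-≤ (λ v → both-orders u v)) ⟩
    ∑[ u < n ] ∑[ v < n ] adjχ u v                 ∎
    where
    below : Fin n → Fin n → ℕ
    below u v = χ ((toℕ u <ᵇ toℕ v) ∧ adj G u v)
    E : ℕ
    E = ∑[ u < n ] ∑[ v < n ] below u v
    edges≡sum : e G ≡ E
    edges≡sum = count-pairs (λ p → (toℕ (proj₁ p) <ᵇ toℕ (proj₂ p)) ∧ adj G (proj₁ p) (proj₂ p))
    both-orders : ∀ u v → below u v + below v u ≤ adjχ u v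
    both-orders u v rewrite Graph.sym G v u with toℕ u <ᵇ toℕ v in u<v | toℕ v <ᵇ toℕ u in v<u
    ... | false | false = z≤n
    ... | false | true  = ≤-refl
    ... | true  | false = ≤-reflexive (+-identityʳ _)
    ... | true  | true  = ⊥-elim (<-asym (<ᵇ⇒< (toℕ u) (toℕ v) (subst T (sym u<v) _))
                                        (<ᵇ⇒< (toℕ v) (toℕ u) (subst T (sym v<u) _)))

-- Taking ρ the indicator of a vertex set R, this says that the
-- induced subgraph G[R] has at most |R|²/4 edges.
module WeightedMantel {n : ℕ} (G : Graph n) (triangle-free : TriangleFree G) (ρ : Fin n → ℕ) where

  r : ℕ
  r = sum ρ

  d : Fin n → ℕ
  d u = ∑[ v < n ] (ρ v * adjχ G u v)

  c : Fin n → Fin n → ℕ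
  c u v = ρ u * (ρ v * adjχ G u v)

  W : ℕ
  W = ∑[ u < n ] ∑[ v < n ] c u v

  c-sym : ∀ u v → c u v ≡ c v u
  c-sym u v rewrite adjχ-sym G u v = swap (ρ u) (ρ v) (adjχ G v u)
    where
    swap : ∀ x y z → x * (y * z) ≡ y * (x * z)
    swap = solve-∀

  W≡∑ρd : W ≡ ∑[ u < n ] (ρ u * d u)
  W≡∑ρd = sum-cong-≗ (λ u → sym (*-distribˡ-sum (ρ u) (λ v → ρ v * adjχ G u v)))

  no-common-neighbour : ∀ u v w → adj G u v ≡ true → adjχ G u w + adjχ G v w ≤ 1
  no-common-neighbour u v w uv with adj G u w in uw | adj G v w in vw
  ... | false | false = z≤n
  ... | false | true  = ≤-refl
  ... | true  | false = ≤-refl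
  ... | true  | true  = ⊥-elim (triangle-free u w v uw (trans (Graph.sym G w v) vw) uv)

  edge-degrees≤r : ∀ u v → adj G u v ≡ true → d u + d v ≤ r
  edge-degrees≤r u v uv = begin
    d u + d v                                       ≡⟨ sym (∑-distrib-+ (λ w → ρ w * adjχ G u w) (λ w → ρ w * adjχ G v w)) ⟩
    ∑[ w < n ] (ρ w * adjχ G u w + ρ w * adjχ G v w) ≡⟨ sum-cong-≗ (λ w → sym (*-distribˡ-+ (ρ w) (adjχ G u w) (adjχ G v w))) ⟩
    ∑[ w < n ] (ρ w * (adjχ G u w + adjχ G v w))     ≤⟨ sum-mono-≤ (λ w → *-monoʳ-≤ (ρ w) (no-common-neighbour u v w uv)) ⟩
    ∑[ w < n ] (ρ w * 1)                             ≡⟨ sum-cong-≗ (λ w → *-identityʳ (ρ w)) ⟩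
    r                                               ∎

  pair-bound : ∀ u v → c u v * (d u + d v) ≤ c u v * r
  pair-bound u v with adj G u v in uv
  ... | true  = *-monoʳ-≤ (ρ u * (ρ v * 1)) (edge-degrees≤r u v uv)
  ... | false rewrite *-zeroʳ (ρ v) | *-zeroʳ (ρ u) = z≤n

  -- Q = ∑ ρᵤ dᵤ² = ∑_{u,v} c(u,v) dᵤ = ∑_{u,v} c(u,v) d_v, so summing the edge
  -- bound over all pairs gives 2Q ≤ rW.
  Q : ℕ
  Q = ∑[ u < n ] (ρ u * (d u * d u))

  Q≡∑cd : Q ≡ ∑[ u < n ] ∑[ v < n ] (c u v * d u)
  Q≡∑cd = sum-cong-≗ (λ u → begin-equality
    ρ u * (d u * d u)                 ≡⟨ sym (*-assoc (ρ u) (d u) (d u)) ⟩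
    ρ u * d u * d u                   ≡⟨ cong (_* d u) (*-distribˡ-sum (ρ u) (λ v → ρ v * adjχ G u v)) ⟩
    ∑[ v < n ] c u v * d u            ≡⟨ *-distribʳ-sum (d u) (c u) ⟩
    ∑[ v < n ] (c u v * d u)          ∎)

  Q≡∑cd′ : Q ≡ ∑[ u < n ] ∑[ v < n ] (c u v * d v)
  Q≡∑cd′ = trans Q≡∑cd (trans (∑-comm (λ u v → c u v * d u))
                              (sum-cong-≗ (λ u → sum-cong-≗ (λ v → cong (_* d v) (c-sym v u)))))

  2Q≤rW : 2 * Q ≤ r * W
  2Q≤rW = begin
    2 * Q                                                   ≡⟨ cong₂ _+_ Q≡∑cd (trans (+-identityʳ Q) Q≡∑cd′) ⟩
    ∑[ u < n ] ∑[ v < n ] (c u v * d u) + ∑[ u < n ] ∑[ v < n ] (c u v * d v)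
                                                            ≡⟨ sym (∑-distrib-+ (λ u → ∑[ v < n ] (c u v * d u)) (λ u → ∑[ v < n ] (c u v * d v))) ⟩
    ∑[ u < n ] (∑[ v < n ] (c u v * d u) + ∑[ v < n ] (c u v * d v))
                                                            ≡⟨ sum-cong-≗ (λ u → sym (∑-distrib-+ (λ v → c u v * d u) (λ v → c u v * d v))) ⟩
    ∑[ u < n ] ∑[ v < n ] (c u v * d u + c u v * d v)       ≡⟨ sum-cong-≗ (λ u → sum-cong-≗ (λ v → sym (*-distribˡ-+ (c u v) (d u) (d v)))) ⟩
    ∑[ u < n ] ∑[ v < n ] (c u v * (d u + d v))             ≤⟨ sum-mono-≤ (λ u → sum-mono-≤ (λ v → pair-bound u v)) ⟩
    ∑[ u < n ] ∑[ v < n ] (c u v * r)                       ≡⟨ sum-cong-≗ (λ u → sym (*-distribʳ-sum r (c u))) ⟩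
    ∑[ u < n ] (∑[ v < n ] c u v * r)                       ≡⟨ sym (*-distribʳ-sum r (λ u → ∑[ v < n ] c u v)) ⟩
    W * r                                                   ≡⟨ *-comm W r ⟩
    r * W                                                   ∎

  W²≤rQ : W * W ≤ r * Q
  W²≤rQ rewrite W≡∑ρd = cauchy-schwarz ρ d

  mantel : 2 * W ≤ r * r
  mantel = cancel W (r * r) (begin
    W * (2 * W)     ≡⟨ solve₁ W ⟩
    2 * (W * W)     ≤⟨ *-monoʳ-≤ 2 W²≤rQ ⟩
    2 * (r * Q)     ≡⟨ solve₂ r Q ⟩
    r * (2 * Q)     ≤⟨ *-monoʳ-≤ r 2Q≤rW ⟩
    r * (r * W)     ≡⟨ solve₃ r W ⟩
    W * (r * r)     ∎)
    where
    cancel : ∀ x z → x * (2 * x) ≤ x * z → 2 * x ≤ z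
    cancel zero    z _ = z≤n
    cancel (suc x) z h = *-cancelˡ-≤ (suc x) h
    solve₁ : ∀ x → x * (2 * x) ≡ 2 * (x * x)
    solve₁ = solve-∀
    solve₂ : ∀ x y → 2 * (x * y) ≡ x * (2 * y)
    solve₂ = solve-∀
    solve₃ : ∀ x y → x * (x * y) ≡ y * (x * x)
    solve₃ = solve-∀

module Decomposition {n : ℕ} (G : Graph n) (A A' : Subset n) (s : ℕ)
  (N-A' : ∀ a' → a' ∈ A' → N G a' ≡ A) (deg-A : ∀ a → a ∈ A → deg G a ≤ s) where

  α : Fin n → ℕ
  α u = χ (Vec.lookup A u)

  ρ : Fin n → ℕ
  ρ u = χ (not (Vec.lookup A u) ∧ not (Vec.lookup A' u))

  adj-from-A' : ∀ u v → Vec.lookup A' u ≡ true → adj G u v ≡ Vec.lookup A v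
  adj-from-A' u v u∈A' = trans (sym (lookup∘tabulate (adj G u) v))
                               (cong (λ S → Vec.lookup S v) (N-A' u (lookup⇒[]= u A' u∈A')))

  -- Every edge uv has u ∈ A, or v ∈ A, or u, v ∈ R: an edge with an end in
  -- A' and the other end outside A is impossible.
  edge-cover : ∀ u v → adjχ G u v ≤ α u * adjχ G u v + α v * adjχ G u v + ρ u * (ρ v * adjχ G u v)
  edge-cover u v with Vec.lookup A u in u∈A
  ... | true  = ≤-trans (≤-reflexive (sym (*-identityˡ (adjχ G u v)))) (≤-trans (m≤m+n _ _) (m≤m+n _ _))
  ... | false with Vec.lookup A v in v∈A
  ...   | true  = ≤-trans (≤-reflexive (sym (*-identityˡ (adjχ G u v)))) (m≤m+n _ _)
  ...   | false with Vec.lookup A' u in u∈A'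
  ...     | true rewrite adj-from-A' u v u∈A' | v∈A = z≤n
  ...     | false with Vec.lookup A' v in v∈A'
  ...       | true rewrite Graph.sym G u v | adj-from-A' v u v∈A' | u∈A = z≤n
  ...       | false = ≤-reflexive (sym (trans (+-identityʳ _) (+-identityʳ _)))

  pairs-from-A : ∑[ u < n ] ∑[ v < n ] (α u * adjχ G u v) ≤ card A * s
  pairs-from-A = begin
    ∑[ u < n ] ∑[ v < n ] (α u * adjχ G u v)
      ≡⟨ sum-cong-≗ (λ u → trans (sym (*-distribˡ-sum (α u) (adjχ G u))) (cong (α u *_) (sym (deg≡sum G u)))) ⟩
    ∑[ u < n ] (α u * deg G u)  ≤⟨ sum-mono-≤ bounded ⟩
    ∑[ u < n ] (α u * s)        ≡⟨ sym (*-distribʳ-sum s α) ⟩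
    sum α * s                   ≡⟨ cong (_* s) (sym (card≡sum A)) ⟩
    card A * s                  ∎
    where
    bounded : ∀ u → α u * deg G u ≤ α u * s
    bounded u with Vec.lookup A u in u∈A
    ... | true  = +-monoˡ-≤ 0 (deg-A u (lookup⇒[]= u A u∈A))
    ... | false = z≤n

  pairs-into-A : ∑[ u < n ] ∑[ v < n ] (α v * adjχ G u v) ≡ ∑[ u < n ] ∑[ v < n ] (α u * adjχ G u v)
  pairs-into-A = trans (sum-cong-≗ (λ u → sum-cong-≗ (λ v → cong (α v *_) (adjχ-sym G u v))))
                       (∑-comm (λ u v → α v * adjχ G v u))

  W-R : ℕ
  W-R = ∑[ u < n ] ∑[ v < n ] (ρ u * (ρ v * adjχ G u v))

  ordered-pairs-bound : ∑[ u < n ] ∑[ v < n ] adjχ G u v ≤ card A * s + card A * s + W-R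
  ordered-pairs-bound = begin
    ∑[ u < n ] ∑[ v < n ] adjχ G u v
      ≤⟨ sum-mono-≤ (λ u → sum-mono-≤ (λ v → edge-cover u v)) ⟩
    ∑[ u < n ] ∑[ v < n ] (α u * adjχ G u v + α v * adjχ G u v + ρ u * (ρ v * adjχ G u v))
      ≡⟨ sum-cong-≗ (λ u → trans (∑-distrib-+ (λ v → α u * adjχ G u v + α v * adjχ G u v) (λ v → ρ u * (ρ v * adjχ G u v)))
                       (cong (_+ ∑[ v < n ] (ρ u * (ρ v * adjχ G u v))) (∑-distrib-+ (λ v → α u * adjχ G u v) (λ v → α v * adjχ G u v)))) ⟩
    ∑[ u < n ] (∑[ v < n ] (α u * adjχ G u v) + ∑[ v < n ] (α v * adjχ G u v) + ∑[ v < n ] (ρ u * (ρ v * adjχ G u v)))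
      ≡⟨ trans (∑-distrib-+ (λ u → ∑[ v < n ] (α u * adjχ G u v) + ∑[ v < n ] (α v * adjχ G u v)) (λ u → ∑[ v < n ] (ρ u * (ρ v * adjχ G u v))))
               (cong (_+ W-R) (∑-distrib-+ (λ u → ∑[ v < n ] (α u * adjχ G u v)) (λ u → ∑[ v < n ] (α v * adjχ G u v)))) ⟩
    P + ∑[ u < n ] ∑[ v < n ] (α v * adjχ G u v) + W-R  ≡⟨ cong (λ x → P + x + W-R) pairs-into-A ⟩
    P + P + W-R                                          ≤⟨ +-monoˡ-≤ W-R (+-mono-≤ pairs-from-A pairs-from-A) ⟩
    card A * s + card A * s + W-R                        ∎
    where
    P : ℕ
    P = ∑[ u < n ] ∑[ v < n ] (α u * adjχ G u v)

  partition : Disjoint A A' → card A + card A' + sum ρ ≡ n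
  partition A∩A'=∅ = begin-equality
    card A + card A' + sum ρ                  ≡⟨ cong₂ (λ x y → x + y + sum ρ) (card≡sum A) (card≡sum A') ⟩
    sum α + sum α' + sum ρ                    ≡⟨ cong (_+ sum ρ) (sym (∑-distrib-+ α α')) ⟩
    ∑[ u < n ] (α u + α' u) + sum ρ           ≡⟨ sym (∑-distrib-+ (λ u → α u + α' u) ρ) ⟩
    ∑[ u < n ] (α u + α' u + ρ u)             ≡⟨ sum-cong-≗ exactly-one ⟩
    ∑[ u < n ] 1                              ≡⟨ sum-ones n ⟩
    n                                         ∎
    where
    α' : Fin n → ℕ
    α' u = χ (Vec.lookup A' u)
    not-both : ∀ u → Vec.lookup A u ∧ Vec.lookup A' u ≡ false
    not-both u = trans (sym (lookup-zipWith _∧_ u A A'))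
                       (trans (cong (λ S → Vec.lookup S u) A∩A'=∅) (lookup-replicate u false))
    exactly-one : ∀ u → α u + α' u + ρ u ≡ 1
    exactly-one u with Vec.lookup A u in u∈A | Vec.lookup A' u in u∈A'
    ... | true  | true  = ⊥-elim (true≢false (trans (sym (cong₂ _∧_ u∈A u∈A')) (not-both u)))
      where
      true≢false : true ≡ false → ⊥
      true≢false ()
    ... | true  | false = refl
    ... | false | true  = refl
    ... | false | false = refl

-- The closing arithmetic.  Write n = 2s + t.  From s + |A'| + r = n and
-- |A'| ≥ 3s − n we get r ≤ 2t; then 4e ≤ 4s² + r² gives e ≤ s² + t², and
-- s² + t² = n² − 4ns + 5s².
rest≤2t : ∀ s t a' r → s + a' + r ≡ 2 * s + t → 3 * s ≤ 2 * s + t + a' → r ≤ 2 * t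
rest≤2t s t a' r partition 3s≤n+a' = +-cancelˡ-≤ (4 * s) r (2 * t) (begin
  4 * s + r                    ≡⟨ regroup₁ s r ⟩
  3 * s + s + r                ≤⟨ +-monoˡ-≤ r (+-monoˡ-≤ s 3s≤n+a') ⟩
  (2 * s + t + a') + s + r     ≡⟨ regroup₂ s t a' r ⟩
  (2 * s + t) + (s + a' + r)   ≡⟨ cong ((2 * s + t) +_) partition ⟩
  (2 * s + t) + (2 * s + t)    ≡⟨ regroup₃ s t ⟩
  4 * s + 2 * t                ∎)
  where
  regroup₁ : ∀ s r → 4 * s + r ≡ 3 * s + s + r
  regroup₁ = solve-∀
  regroup₂ : ∀ s t a' r → (2 * s + t + a') + s + r ≡ (2 * s + t) + (s + a' + r)
  regroup₂ = solve-∀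
  regroup₃ : ∀ s t → (2 * s + t) + (2 * s + t) ≡ 4 * s + 2 * t
  regroup₃ = solve-∀

final-arithmetic : ∀ n s m a' r → 4 * m ≤ 4 * (s * s) + r * r →
  s + a' + r ≡ n → 3 * s ≤ n + a' → 2 * s ≤ n → m + 4 * n * s ≤ n ^ 2 + 5 * s ^ 2
final-arithmetic n s m a' r 4m≤ partition 3s≤n+a' 2s≤n with m≤n⇒∃[o]m+o≡n 2s≤n
... | t , refl = begin
  m + 4 * (2 * s + t) * s             ≤⟨ +-monoˡ-≤ (4 * (2 * s + t) * s) m≤s²+t² ⟩
  s * s + t * t + 4 * (2 * s + t) * s ≡⟨ identity s t ⟩
  (2 * s + t) ^ 2 + 5 * s ^ 2         ∎
  where
  r≤2t : r ≤ 2 * t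
  r≤2t = rest≤2t s t a' r partition 3s≤n+a'
  m≤s²+t² : m ≤ s * s + t * t
  m≤s²+t² = *-cancelˡ-≤ 4 (begin
    4 * m                           ≤⟨ 4m≤ ⟩
    4 * (s * s) + r * r             ≤⟨ +-monoʳ-≤ (4 * (s * s)) (*-mono-≤ r≤2t r≤2t) ⟩
    4 * (s * s) + (2 * t) * (2 * t) ≡⟨ expand s t ⟩
    4 * (s * s + t * t)             ∎)
    where
    expand : ∀ s t → 4 * (s * s) + (2 * t) * (2 * t) ≡ 4 * (s * s + t * t)
    expand = solve-∀
  -- x ^ 2 unfolds to x * (x * 1), which is the form the ring solver accepts.
  identity : ∀ s t → s * s + t * t + 4 * (2 * s + t) * s ≡ (2 * s + t) * ((2 * s + t) * 1) + 5 * (s * (s * 1))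
  identity = solve-∀

-- Lemma 3.1.
lemma3p1 : (n s : ℕ) → 1 ≤ n → 1 ≤ s → n ≤ 3 * s → 2 * s ≤ n →
    (G : Graph n) → TriangleFree G →
    (A A' : Subset n) → Independent G A → Independent G A' → Disjoint A A' →
    card A ≡ s → 3 * s ≤ n + card A' →
    (∀ a → a ∈ A → deg G a ≤ s) →
    (∀ a' → a' ∈ A' → N G a' ≡ A) →
    e G + 4 * n * s ≤ n ^ 2 + 5 * s ^ 2
lemma3p1 n s _ _ _ 2s≤n G triangle-free A A' _ _ disjoint refl 3s≤n+a' deg-A N-A' =
  final-arithmetic n s (e G) (card A') (sum ρ) four-edges (partition disjoint) 3s≤n+a' 2s≤n
  where
  open Decomposition G A A' s N-A' deg-A
  open WeightedMantel G triangle-free ρ using (mantel)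
  four-edges : 4 * e G ≤ 4 * (s * s) + sum ρ * sum ρ
  four-edges = begin
    4 * e G                             ≡⟨ *-assoc 2 2 (e G) ⟩
    2 * (2 * e G)                       ≤⟨ *-monoʳ-≤ 2 (≤-trans (handshake G) ordered-pairs-bound) ⟩
    2 * (s * s + s * s + W-R)           ≡⟨ regroup (s * s) W-R ⟩
    4 * (s * s) + 2 * W-R               ≤⟨ +-monoʳ-≤ (4 * (s * s)) mantel ⟩
    4 * (s * s) + sum ρ * sum ρ         ∎
    where
    regroup : ∀ x w → 2 * (x + x + w) ≡ 4 * x + 2 * w
    regroup = solve-∀
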